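{- Let $n\ge 18$ be even and let $f=(V_1,\dots,V_\ell)$ be a proper coloring of $C_n(1,3)$ with color classes $V_1,\dots,V_\ell$. If $|V_i|\ge n/2-2$ for some $i$, then $f$ is not a total dominator coloring of $C_n(1,3)$.
   Context: $C_n(1,3)$ is the simple graph with vertex set $\{1,\dots,n\}$ in which distinct vertices $i,j$ are adjacent iff $i-j\equiv \pm1$ or $\pm 3 \pmod n$. A total dominator coloring of a graph $G$ is a proper vertex coloring of $G$ in which every vertex is adjacent to all vertices of at least one color class. -}

module Defs where

open import Data.Nat using (ℕ; suc; _+_; _*_; _%_; _≥_; NonZero)
open import Data.Fin using (Fin; toℕ)
open import Data.Fin.Properties using (_≟_)
open import Data.List using (List; length; filter; allFin)
open import Data.Product using (Σ; ∃; _×_)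
open import Data.Sum using (_⊎_)
open import Relation.Binary.PropositionalEquality using (_≡_; _≢_)

-- Vertices of C_n(1,3) are Fin n (vertex i+1 of the paper is i here).
-- Distinct i, j are adjacent iff j ≡ i ± 1 or i ± 3 (mod n).
Circulant13 : (n : ℕ) .{{_ : NonZero n}} → Fin n → Fin n → Set
Circulant13 n i j =
  i ≢ j ×
  ( (toℕ j ≡ (toℕ i + 1) % n) ⊎ (toℕ i ≡ (toℕ j + 1) % n)
  ⊎ (toℕ j ≡ (toℕ i + 3) % n) ⊎ (toℕ i ≡ (toℕ j + 3) % n))

-- A coloring with colors 0..ℓ-1; the color class V_k is the fiber c⁻¹(k).
Proper : (n : ℕ) .{{_ : NonZero n}} {ℓ : ℕ} → (Fin n → Fin ℓ) → Set
Proper n c = ∀ u v → Circulant13 n u v → c u ≢ c v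

classSize : {n ℓ : ℕ} → (Fin n → Fin ℓ) → Fin ℓ → ℕ
classSize {n} c k = length (filter (λ v → c v ≟ k) (allFin n))

TotalDominator : (n : ℕ) .{{_ : NonZero n}} {ℓ : ℕ} → (Fin n → Fin ℓ) → Set
TotalDominator n c =
  ∀ v → Σ _ λ k → (∃ λ w → c w ≡ k) × (∀ w → c w ≡ k → Circulant13 n v w)

-- Write n = 2m and group the vertices into the m blocks {2j, 2j+1}. A colour class V meets
-- each block at most once (2j ~ 2j+1), and in consecutive occupied blocks it sits at the same
-- position, since otherwise its two vertices differ by 1 or 3. So four consecutive occupied
-- blocks put x, x+2, x+4, x+6 in V; then every neighbour of x+3 lies in V, hence x+3 must
-- dominate V itself, and V ⊆ N(x+3) has at most 4 vertices. Thus if |V| ≥ n/2 - 2 ≥ 7, each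
-- of the m cyclic windows of four consecutive blocks has an empty block, and averaging over
-- the windows gives 4|V| ≤ 3m, contradicting |V| ≥ m - 2 for m ≥ 9.

module Submission where

open import Defs
open import Data.Nat using (ℕ; zero; suc; _+_; _*_; _∸_; _≤_; _<_; _%_; z≤n; s≤s; NonZero; pred; _<?_)
open import Data.Nat.Properties hiding (_≟_)
open import Data.Nat.DivMod
open import Data.Nat.Divisibility using (_∣_; divides)
open import Data.Nat.Tactic.RingSolver using (solve-∀)
open import Algebra.Properties.CommutativeSemigroup +-commutativeSemigroup using (interchange)
open import Data.Fin using (Fin; toℕ)
open import Data.Fin.Properties using (toℕ-fromℕ<; toℕ-injective; toℕ<n; _≟_)
open import Data.List using (_∷_; length; filter; tabulate)
open import Data.Product using (Σ; ∃-syntax; _×_; _,_)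
open import Data.Sum using (_⊎_; inj₁; inj₂)
open import Data.Empty using (⊥; ⊥-elim)
open import Relation.Nullary using (¬_; Dec; yes; no; contradiction)
open import Relation.Unary using (Pred; Decidable)
open import Relation.Binary.PropositionalEquality

∑< : ℕ → (ℕ → ℕ) → ℕ
∑< zero    f = 0
∑< (suc m) f = f 0 + ∑< m (λ j → f (suc j))

syntax ∑< m (λ j → e) = ∑[ j < m ] e

∑<-cong : ∀ m {f g : ℕ → ℕ} → (∀ j → f j ≡ g j) → ∑< m f ≡ ∑< m g
∑<-cong zero    f≡g = refl
∑<-cong (suc m) f≡g = cong₂ _+_ (f≡g 0) (∑<-cong m (λ j → f≡g (suc j)))

∑<-mono-≤ : ∀ m {f g : ℕ → ℕ} → (∀ j → f j ≤ g j) → ∑< m f ≤ ∑< m g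
∑<-mono-≤ zero    f≤g = z≤n
∑<-mono-≤ (suc m) f≤g = +-mono-≤ (f≤g 0) (∑<-mono-≤ m (λ j → f≤g (suc j)))

∑<-const : ∀ m k → ∑[ j < m ] k ≡ m * k
∑<-const zero    k = refl
∑<-const (suc m) k = cong (k +_) (∑<-const m k)

∑<-distrib-+ : ∀ m (f g : ℕ → ℕ) → ∑[ j < m ] (f j + g j) ≡ ∑< m f + ∑< m g
∑<-distrib-+ zero    f g = refl
∑<-distrib-+ (suc m) f g =
  trans (cong (f 0 + g 0 +_) (∑<-distrib-+ m _ _)) (interchange (f 0) (g 0) _ _)

∑<-comm : ∀ m w (h : ℕ → ℕ → ℕ) → ∑[ j < m ] ∑[ t < w ] h t j ≡ ∑[ t < w ] ∑[ j < m ] h t j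
∑<-comm m zero    h = trans (∑<-const m 0) (*-zeroʳ m)
∑<-comm m (suc w) h =
  trans (∑<-distrib-+ m (h 0) _) (cong (∑< m (h 0) +_) (∑<-comm m w (λ t → h (suc t))))

∑<-suc : ∀ m (f : ℕ → ℕ) → ∑< (suc m) f ≡ ∑< m f + f m
∑<-suc zero    f = +-comm (f 0) 0
∑<-suc (suc m) f = trans (cong (f 0 +_) (∑<-suc m (λ j → f (suc j)))) (sym (+-assoc (f 0) _ _))

∑<-+ : ∀ a b (f : ℕ → ℕ) → ∑< (a + b) f ≡ ∑< a f + ∑[ j < b ] f (a + j)
∑<-+ zero    b f = refl
∑<-+ (suc a) b f = trans (cong (f 0 +_) (∑<-+ a b (λ j → f (suc j)))) (sym (+-assoc (f 0) _ _))

∑<-* : ∀ m k (f : ℕ → ℕ) → ∑< (m * k) f ≡ ∑[ j < m ] ∑[ e < k ] f (k * j + e)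
∑<-* zero    k f = refl
∑<-* (suc m) k f = begin
  ∑< (k + m * k) f
    ≡⟨ ∑<-+ k (m * k) f ⟩
  ∑< k f + ∑[ j < m * k ] f (k + j)
    ≡⟨ cong₂ _+_ (∑<-cong k first-block) (∑<-* m k (λ j → f (k + j))) ⟩
  ∑[ e < k ] f (k * 0 + e) + ∑[ j < m ] ∑[ e < k ] f (k + (k * j + e))
    ≡⟨ cong (∑[ e < k ] f (k * 0 + e) +_) (∑<-cong m (λ j → ∑<-cong k (next-block j))) ⟩
  ∑[ j < suc m ] ∑[ e < k ] f (k * j + e)
    ∎
  where
  open ≡-Reasoning
  first-block : ∀ e → f e ≡ f (k * 0 + e)
  first-block e = cong (λ z → f (z + e)) (sym (*-zeroʳ k))
  next-block : ∀ j e → f (k + (k * j + e)) ≡ f (k * suc j + e)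
  next-block j e = cong f (trans (sym (+-assoc k (k * j) e)) (cong (_+ e) (sym (*-suc k j))))

∑<-periodic-shift : ∀ m (f : ℕ → ℕ) → (∀ j → f (j + m) ≡ f j) →
                    ∀ t → ∑[ j < m ] f (t + j) ≡ ∑< m f
∑<-periodic-shift m f periodic zero    = refl
∑<-periodic-shift m f periodic (suc t) = +-cancelˡ-≡ (f t) _ _ (begin
  f t + ∑[ j < m ] f (suc t + j)   ≡⟨ cong₂ _+_ (cong f (sym (+-identityʳ t)))
                                               (∑<-cong m (λ j → cong f (sym (+-suc t j)))) ⟩
  ∑[ j < suc m ] f (t + j)         ≡⟨ ∑<-suc m (λ j → f (t + j)) ⟩
  ∑[ j < m ] f (t + j) + f (t + m) ≡⟨ cong₂ _+_ (∑<-periodic-shift m f periodic t) (periodic t) ⟩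
  ∑< m f + f t                     ≡⟨ +-comm (∑< m f) (f t) ⟩
  f t + ∑< m f                     ∎)
  where open ≡-Reasoning

∑<-≤-support : ∀ m r (f : ℕ → ℕ) → (∀ j → f j ≤ 1) → (∀ j → r ≤ j → j < m → f j ≡ 0) →
               ∑< m f ≤ r
∑<-≤-support zero    r       f f≤1 vanish = z≤n
∑<-≤-support (suc m) zero    f f≤1 vanish =
  ≤-reflexive (cong₂ _+_ (vanish 0 z≤n (s≤s z≤n))
    (n≤0⇒n≡0 (∑<-≤-support m 0 _ (λ j → f≤1 (suc j))
                                  (λ j _ j<m → vanish (suc j) z≤n (s≤s j<m)))))
∑<-≤-support (suc m) (suc r) f f≤1 vanish =
  +-mono-≤ (f≤1 0) (∑<-≤-support m r _ (λ j → f≤1 (suc j))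
                                        (λ j r≤j j<m → vanish (suc j) (s≤s r≤j) (s≤s j<m)))

∑<-< : ∀ w (f : ℕ → ℕ) → (∀ j → f j ≤ 1) → ∀ t → t < w → f t ≡ 0 → ∑< w f < w
∑<-< (suc w) f f≤1 zero    _         f0≡0 =
  s≤s (≤-trans (≤-reflexive (cong (_+ ∑< w (λ j → f (suc j))) f0≡0))
                (∑<-≤-support w w _ (λ j → f≤1 (suc j)) (λ j w≤j j<w → ⊥-elim (<⇒≱ j<w w≤j))))
∑<-< (suc w) f f≤1 (suc t) (s≤s t<w) ft≡0 =
  +-mono-≤-< (f≤1 0) (∑<-< w _ (λ j → f≤1 (suc j)) t t<w ft≡0)

∑<-window-average : ∀ m w b (f : ℕ → ℕ) → (∀ j → f (j + m) ≡ f j) →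
                    (∀ k → ∑[ t < w ] f (t + k) ≤ b) → w * ∑< m f ≤ m * b
∑<-window-average m w b f periodic window = begin
  w * ∑< m f                         ≡⟨ ∑<-const w (∑< m f) ⟨
  ∑[ t < w ] ∑< m f                  ≡⟨ ∑<-cong w (λ t → ∑<-periodic-shift m f periodic t) ⟨
  ∑[ t < w ] ∑[ k < m ] f (t + k)    ≡⟨ ∑<-comm m w (λ t k → f (t + k)) ⟨
  ∑[ k < m ] ∑[ t < w ] f (t + k)    ≤⟨ ∑<-mono-≤ m window ⟩
  ∑[ k < m ] b                       ≡⟨ ∑<-const m b ⟩
  m * b                              ∎
  where open ≤-Reasoning

𝟙 : ∀ {a} {A : Set a} → Dec A → ℕ
𝟙 (yes _) = 1
𝟙 (no  _) = 0

𝟙≡0⊎ : ∀ {a} {A : Set a} (a? : Dec A) → 𝟙 a? ≡ 0 ⊎ A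
𝟙≡0⊎ (yes a) = inj₂ a
𝟙≡0⊎ (no  _) = inj₁ refl

𝟙-no : ∀ {a} {A : Set a} (a? : Dec A) → ¬ A → 𝟙 a? ≡ 0
𝟙-no (yes a) ¬a = contradiction a ¬a
𝟙-no (no  _) _  = refl

𝟙+𝟙≤1 : ∀ {a b} {A : Set a} {B : Set b} (a? : Dec A) (b? : Dec B) →
        (A → B → ⊥) → 𝟙 a? + 𝟙 b? ≤ 1
𝟙+𝟙≤1 (yes a) (yes b) ¬ab = ⊥-elim (¬ab a b)
𝟙+𝟙≤1 (yes _) (no  _) _   = s≤s z≤n
𝟙+𝟙≤1 (no  _) (yes _) _   = s≤s z≤n
𝟙+𝟙≤1 (no  _) (no  _) _   = z≤n

module _ {a p} {A : Set a} {P : Pred A p} (P? : Decidable P) where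

  length-filter-∷ : ∀ x xs → length (filter P? (x ∷ xs)) ≡ 𝟙 (P? x) + length (filter P? xs)
  length-filter-∷ x xs with P? x
  ... | yes _ = refl
  ... | no  _ = refl

  length-filter-tabulate : ∀ k (f : Fin k → A) (g : ℕ → ℕ) → (∀ v → 𝟙 (P? (f v)) ≡ g (toℕ v)) →
                           length (filter P? (tabulate f)) ≡ ∑< k g
  length-filter-tabulate zero    f g f≗g = refl
  length-filter-tabulate (suc k) f g f≗g =
    trans (length-filter-∷ (f Fin.zero) (tabulate (λ v → f (Fin.suc v))))
          (cong₂ _+_ (f≗g Fin.zero)
                     (length-filter-tabulate k (λ v → f (Fin.suc v)) (λ j → g (suc j))
                                             (λ v → f≗g (Fin.suc v))))

data Offset : ℕ → Set where
  one   : Offset 1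
  three : Offset 3

Offset⇒≤3 : ∀ {d} → Offset d → d ≤ 3
Offset⇒≤3 one   = s≤s z≤n
Offset⇒≤3 three = ≤-refl

Offset⇒≢0 : ∀ {d} → Offset d → d ≢ 0
Offset⇒≢0 one   ()
Offset⇒≢0 three ()

module CirculantVertices (n : ℕ) .{{_ : NonZero n}} (3<n : 3 < n) where

  V : ℕ → Fin n
  V x = x mod n

  toℕ-V : ∀ x → toℕ (V x) ≡ x % n
  toℕ-V x = toℕ-fromℕ< (m%n<n x n)

  V-toℕ : ∀ v → V (toℕ v) ≡ v
  V-toℕ v = toℕ-injective (trans (toℕ-V (toℕ v)) (m<n⇒m%n≡m (toℕ<n v)))

  V-cong : ∀ {x y} → x % n ≡ y % n → V x ≡ V y
  V-cong {x} {y} eq = toℕ-injective (trans (toℕ-V x) (trans eq (sym (toℕ-V y))))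

  V-injective : ∀ {x y} → V x ≡ V y → x % n ≡ y % n
  V-injective {x} {y} eq = trans (sym (toℕ-V x)) (trans (cong toℕ eq) (toℕ-V y))

  %-+-cong : ∀ x y d → x % n ≡ y % n → (x + d) % n ≡ (y + d) % n
  %-+-cong x y d eq = begin
    (x + d) % n             ≡⟨ %-distribˡ-+ x d n ⟩
    (x % n + d % n) % n     ≡⟨ cong (λ z → (z + d % n) % n) eq ⟩
    (y % n + d % n) % n     ≡⟨ %-distribˡ-+ y d n ⟨
    (y + d) % n             ∎
    where open ≡-Reasoning

  -- Adding d * pred n after d gives a multiple of n, which undoes the shift.
  %-+-cancelʳ : ∀ x y d → (x + d) % n ≡ (y + d) % n → x % n ≡ y % n
  %-+-cancelʳ x y d eq = begin
    x % n                         ≡⟨ unshift x ⟨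
    (x + d + d * pred n) % n      ≡⟨ %-+-cong (x + d) (y + d) (d * pred n) eq ⟩
    (y + d + d * pred n) % n      ≡⟨ unshift y ⟩
    y % n                         ∎
    where
    open ≡-Reasoning
    unshift : ∀ z → (z + d + d * pred n) % n ≡ z % n
    unshift z = begin
      (z + d + d * pred n) % n    ≡⟨ cong (_% n) (+-assoc z d (d * pred n)) ⟩
      (z + (d + d * pred n)) % n  ≡⟨ cong (λ k → (z + k) % n) (sym (*-suc d (pred n))) ⟩
      (z + d * suc (pred n)) % n  ≡⟨ cong (λ k → (z + d * k) % n) (suc-pred n) ⟩
      (z + d * n) % n             ≡⟨ [m+kn]%n≡m%n z d n ⟩
      z % n                       ∎

  %-+-cancelˡ : ∀ a x y → (a + x) % n ≡ (a + y) % n → x % n ≡ y % n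
  %-+-cancelˡ a x y eq =
    %-+-cancelʳ x y a (trans (cong (_% n) (+-comm x a)) (trans eq (cong (_% n) (+-comm a y))))

  %-<-double : ∀ z → z < n + n → z % n ≡ z ⊎ z % n + n ≡ z
  %-<-double z z<2n with z <? n
  ... | yes z<n = inj₁ (m<n⇒m%n≡m z<n)
  ... | no  z≮n = inj₂ (begin
    z % n + n           ≡⟨ cong (_+ n) (m≤n⇒[n∸m]%m≡n%m n≤z) ⟨
    (z ∸ n) % n + n     ≡⟨ cong (_+ n) (m<n⇒m%n≡m (+-cancelʳ-< n (z ∸ n) n z∸n+n<2n)) ⟩
    z ∸ n + n           ≡⟨ m∸n+n≡m n≤z ⟩
    z                   ∎)
    where
    open ≡-Reasoning
    n≤z : n ≤ z
    n≤z = ≮⇒≥ z≮n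
    z∸n+n<2n : z ∸ n + n < n + n
    z∸n+n<2n = subst (_< n + n) (sym (m∸n+n≡m n≤z)) z<2n

  toℕ-V-+ : ∀ x d → (toℕ (V x) + d) % n ≡ (x + d) % n
  toℕ-V-+ x d = %-+-cong (toℕ (V x)) x d (trans (cong (_% n) (toℕ-V x)) (m%n%n≡m%n x n))

  step-% : ∀ x y {d} → toℕ (V y) ≡ (toℕ (V x) + d) % n → (x + d) % n ≡ y % n
  step-% x y {d} e = sym (trans (sym (toℕ-V y)) (trans e (toℕ-V-+ x d)))

  toℕ-V-shift : ∀ x {d} → toℕ (V (x + d)) ≡ (toℕ (V x) + d) % n
  toℕ-V-shift x {d} = trans (toℕ-V (x + d)) (sym (toℕ-V-+ x d))

  adjacent⇒offset : ∀ x y → Circulant13 n (V x) (V y) →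
    ∃[ d ] Offset d × ((x + d) % n ≡ y % n ⊎ (y + d) % n ≡ x % n)
  adjacent⇒offset x y (_ , inj₁ e)               = 1 , one   , inj₁ (step-% x y e)
  adjacent⇒offset x y (_ , inj₂ (inj₁ e))        = 1 , one   , inj₂ (step-% y x e)
  adjacent⇒offset x y (_ , inj₂ (inj₂ (inj₁ e))) = 3 , three , inj₁ (step-% x y e)
  adjacent⇒offset x y (_ , inj₂ (inj₂ (inj₂ e))) = 3 , three , inj₂ (step-% y x e)

  V-+-offset-≢ : ∀ {d} → Offset d → ∀ x → V x ≢ V (x + d)
  V-+-offset-≢ {d} o x eq = Offset⇒≢0 o (begin
    d       ≡⟨ m<n⇒m%n≡m (≤-<-trans (Offset⇒≤3 o) 3<n) ⟨
    d % n   ≡⟨ %-+-cancelˡ x 0 d (trans (cong (_% n) (+-identityʳ x)) (V-injective eq)) ⟨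
    0 % n   ≡⟨ m<n⇒m%n≡m (<-≤-trans (s≤s z≤n) 3<n) ⟩
    0       ∎)
    where open ≡-Reasoning

  offset⇒adjacent : ∀ {d} → Offset d → ∀ x → Circulant13 n (V x) (V (x + d))
  offset⇒adjacent one   x = V-+-offset-≢ one x   , inj₁ (toℕ-V-shift x)
  offset⇒adjacent three x = V-+-offset-≢ three x , inj₂ (inj₂ (inj₁ (toℕ-V-shift x)))

  ≡V : ∀ u x → toℕ u % n ≡ x % n → u ≡ V x
  ≡V u x eq = trans (sym (V-toℕ u)) (V-cong eq)

  neighbours-of-centre : ∀ x u → Circulant13 n (V (x + 3)) u →
    u ≡ V x ⊎ u ≡ V (x + 2) ⊎ u ≡ V (x + 4) ⊎ u ≡ V (x + 6)
  neighbours-of-centre x u adj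
    with adjacent⇒offset (x + 3) (toℕ u) (subst (Circulant13 n (V (x + 3))) (sym (V-toℕ u)) adj)
  ... | _ , one   , inj₁ e =
    inj₂ (inj₂ (inj₁ (≡V u (x + 4) (sym (trans (cong (_% n) (sym (+-assoc x 3 1))) e)))))
  ... | _ , three , inj₁ e =
    inj₂ (inj₂ (inj₂ (≡V u (x + 6) (sym (trans (cong (_% n) (sym (+-assoc x 3 3))) e)))))
  ... | _ , one   , inj₂ e =
    inj₂ (inj₁ (≡V u (x + 2) (%-+-cancelʳ (toℕ u) (x + 2) 1 (trans e (cong (_% n) (sym (+-assoc x 2 1)))))))
  ... | _ , three , inj₂ e =
    inj₁ (≡V u x (%-+-cancelʳ (toℕ u) x 3 e))

  short-offset-% : ∀ {d} → Offset d → ∀ x y → x + 4 ≤ y → y < n → (x + d) % n ≢ y % n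
  short-offset-% {d} o x y x+4≤y y<n e = <⇒≢ x+d<y (begin
    x + d         ≡⟨ m<n⇒m%n≡m (<-trans x+d<y y<n) ⟨
    (x + d) % n   ≡⟨ e ⟩
    y % n         ≡⟨ m<n⇒m%n≡m y<n ⟩
    y             ∎)
    where
    open ≡-Reasoning
    x+d<y : x + d < y
    x+d<y = <-≤-trans (+-monoʳ-< x (s≤s (Offset⇒≤3 o))) x+4≤y

  wrapping-offset-% : ∀ {d} → Offset d → ∀ x y → x + 4 ≤ y → y < n → y + 4 ≤ n + x →
                      (y + d) % n ≢ x % n
  wrapping-offset-% {d} o x y x+4≤y y<n y+4≤n+x e =
    reduced-or-wrapped (%-<-double (y + d) (+-mono-< y<n (≤-<-trans (Offset⇒≤3 o) 3<n)))
    where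
    x<y : x < y
    x<y = <-≤-trans (m<m+n x (s≤s z≤n)) x+4≤y
    y+d%n≡x : (y + d) % n ≡ x
    y+d%n≡x = trans e (m<n⇒m%n≡m (<-trans x<y y<n))
    reduced-or-wrapped : (y + d) % n ≡ y + d ⊎ (y + d) % n + n ≡ y + d → ⊥
    reduced-or-wrapped (inj₁ reduced) =
      <⇒≢ (<-≤-trans x<y (m≤m+n y d)) (trans (sym y+d%n≡x) reduced)
    reduced-or-wrapped (inj₂ wrapped) =
      <⇒≢ (<-≤-trans (+-monoʳ-< y (s≤s (Offset⇒≤3 o))) y+4≤n+x)
          (trans (sym wrapped) (trans (cong (_+ n) y+d%n≡x) (+-comm x n)))

  far⇒nonadjacent : ∀ a x y → x + 4 ≤ y → y < n → y + 4 ≤ n + x →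
                    ¬ Circulant13 n (V (a + x)) (V (a + y))
  far⇒nonadjacent a x y x+4≤y y<n y+4≤n+x adj with adjacent⇒offset (a + x) (a + y) adj
  ... | d , o , inj₁ e =
    short-offset-% o x y x+4≤y y<n (%-+-cancelˡ a (x + d) y (trans (cong (_% n) (sym (+-assoc a x d))) e))
  ... | d , o , inj₂ e =
    wrapping-offset-% o x y x+4≤y y<n y+4≤n+x
      (%-+-cancelˡ a (y + d) x (trans (cong (_% n) (sym (+-assoc a y d))) e))

monochromatic-neighbourhood⇒dominates :
  ∀ n .{{_ : NonZero n}} {ℓ} (c : Fin n → Fin ℓ) → TotalDominator n c →
  ∀ w i → (∀ u → Circulant13 n w u → c u ≡ i) → ∀ v → c v ≡ i → Circulant13 n w v
monochromatic-neighbourhood⇒dominates n c td w i neighbours⊆i v cv≡i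
  with td w
... | k , (u , cu≡k) , dominated =
  dominated v (trans cv≡i (trans (sym (neighbours⊆i u (dominated u cu≡k))) cu≡k))

module ColourClass (n : ℕ) .{{_ : NonZero n}} (m : ℕ) (n≡m*2 : n ≡ m * 2) (3<n : 3 < n)
                   {ℓ} (c : Fin n → Fin ℓ) (proper : Proper n c) (i : Fin ℓ) where

  open CirculantVertices n 3<n

  InClass : ℕ → Set
  InClass x = c (V x) ≡ i

  χ : ℕ → ℕ
  χ x = 𝟙 (c (V x) ≟ i)

  blockCount : ℕ → ℕ
  blockCount j = ∑[ e < 2 ] χ (2 * j + e)

  Occupied : ℕ → Set
  Occupied j = ∃[ e ] e ≤ 1 × InClass (2 * j + e)

  classSize≡∑blockCount : classSize c i ≡ ∑< m blockCount
  classSize≡∑blockCount = begin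
    classSize c i   ≡⟨ length-filter-tabulate (λ v → c v ≟ i) n (λ v → v) χ
                         (λ v → cong (λ u → 𝟙 (c u ≟ i)) (sym (V-toℕ v))) ⟩
    ∑< n χ          ≡⟨ cong (λ k → ∑< k χ) n≡m*2 ⟩
    ∑< (m * 2) χ    ≡⟨ ∑<-* m 2 χ ⟩
    ∑< m blockCount ∎
    where open ≡-Reasoning

  blockCount-periodic : ∀ j → blockCount (j + m) ≡ blockCount j
  blockCount-periodic j = ∑<-cong 2 (λ e → cong (λ u → 𝟙 (c u ≟ i)) (V-cong (begin
    (2 * (j + m) + e) % n   ≡⟨ cong (_% n) (two-blocks-later j m e) ⟩
    (2 * j + e + m * 2) % n ≡⟨ cong (λ k → (2 * j + e + k) % n) n≡m*2 ⟨
    (2 * j + e + n) % n     ≡⟨ [m+n]%n≡m%n (2 * j + e) n ⟩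
    (2 * j + e) % n         ∎)))
    where
    open ≡-Reasoning
    two-blocks-later : ∀ a b d → 2 * (a + b) + d ≡ 2 * a + d + b * 2
    two-blocks-later = solve-∀

  in-class-nonadjacent : ∀ {d} → Offset d → ∀ x → InClass x → ¬ InClass (x + d)
  in-class-nonadjacent {d} o x hx hy = proper (V x) (V (x + d)) (offset⇒adjacent o x) (trans hx (sym hy))

  blockCount≤1 : ∀ j → blockCount j ≤ 1
  blockCount≤1 j = subst (_≤ 1) (cong (χ (2 * j + 0) +_) (sym (+-identityʳ (χ (2 * j + 1)))))
    (𝟙+𝟙≤1 (c (V (2 * j + 0)) ≟ i) (c (V (2 * j + 1)) ≟ i)
      (λ h₀ h₁ → in-class-nonadjacent one (2 * j + 0) h₀ (subst InClass (sym (+-assoc (2 * j) 0 1)) h₁)))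

  blockCount-vacant : ∀ j → (∀ e → e ≤ 1 → ¬ InClass (2 * j + e)) → blockCount j ≡ 0
  blockCount-vacant j vacant =
    cong₂ _+_ (𝟙-no (c (V (2 * j + 0)) ≟ i) (vacant 0 z≤n))
              (cong (_+ 0) (𝟙-no (c (V (2 * j + 1)) ≟ i) (vacant 1 (s≤s z≤n))))

  block-occupancy : ∀ j → blockCount j ≡ 0 ⊎ Occupied j
  block-occupancy j with 𝟙≡0⊎ (c (V (2 * j + 0)) ≟ i) | 𝟙≡0⊎ (c (V (2 * j + 1)) ≟ i)
  ... | inj₂ h₀   | _         = inj₂ (0 , z≤n , h₀)
  ... | _         | inj₂ h₁   = inj₂ (1 , s≤s z≤n , h₁)
  ... | inj₁ χ₀≡0 | inj₁ χ₁≡0 = inj₁ (cong₂ _+_ χ₀≡0 (cong (_+ 0) χ₁≡0))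

  occupied-consecutive : ∀ j {e e′} → e ≤ 1 → e′ ≤ 1 →
                         InClass (2 * j + e) → InClass (2 * suc j + e′) → e ≡ e′
  occupied-consecutive j z≤n       z≤n       _  _  = refl
  occupied-consecutive j (s≤s z≤n) (s≤s z≤n) _  _  = refl
  occupied-consecutive j z≤n       (s≤s z≤n) h h′ =
    ⊥-elim (in-class-nonadjacent three (2 * j + 0) h (subst InClass (three-later j) h′))
    where
    three-later : ∀ a → 2 * suc a + 1 ≡ 2 * a + 0 + 3
    three-later = solve-∀
  occupied-consecutive j (s≤s z≤n) z≤n       h h′ =
    ⊥-elim (in-class-nonadjacent one (2 * j + 1) h (subst InClass (one-later j) h′))
    where
    one-later : ∀ a → 2 * suc a + 0 ≡ 2 * a + 1 + 1
    one-later = solve-∀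

  2*j+e<n : ∀ {j e} → j < m → e ≤ 1 → 2 * j + e < n
  2*j+e<n {j} {e} j<m e≤1 = begin-strict
    2 * j + e     <⟨ +-monoʳ-< (2 * j) (s≤s e≤1) ⟩
    2 * j + 2     ≡⟨ trans (+-comm (2 * j) 2) (sym (*-suc 2 j)) ⟩
    2 * suc j     ≤⟨ *-monoʳ-≤ 2 j<m ⟩
    2 * m         ≡⟨ *-comm 2 m ⟩
    m * 2         ≡⟨ n≡m*2 ⟨
    n             ∎
    where open ≤-Reasoning

  module _ (td : TotalDominator n c) where

    run-of-four⇒confined : ∀ a e → e ≤ 1 →
      InClass (a + e) → InClass (a + e + 2) → InClass (a + e + 4) → InClass (a + e + 6) →
      ∀ y → 8 ≤ y → y < n → ¬ InClass (a + y)
    run-of-four⇒confined a e e≤1 h₀ h₂ h₄ h₆ y 8≤y y<n hy =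
      far⇒nonadjacent a (e + 3) y e+3+4≤y y<n y+4≤n+e+3
        (subst (λ x → Circulant13 n (V x) (V (a + y))) (+-assoc a e 3) (dominates (V (a + y)) hy))
      where
      neighbours-in-class : ∀ u → Circulant13 n (V (a + e + 3)) u → c u ≡ i
      neighbours-in-class u adj with neighbours-of-centre (a + e) u adj
      ... | inj₁ refl                 = h₀
      ... | inj₂ (inj₁ refl)          = h₂
      ... | inj₂ (inj₂ (inj₁ refl))   = h₄
      ... | inj₂ (inj₂ (inj₂ refl))   = h₆
      dominates : ∀ v → c v ≡ i → Circulant13 n (V (a + e + 3)) v
      dominates = monochromatic-neighbourhood⇒dominates n c td (V (a + e + 3)) i neighbours-in-class
      e+3+4≤y : e + 3 + 4 ≤ y
      e+3+4≤y = ≤-trans (≤-reflexive (+-assoc e 3 4)) (≤-trans (+-monoˡ-≤ 7 e≤1) 8≤y)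
      y+4≤n+e+3 : y + 4 ≤ n + (e + 3)
      y+4≤n+e+3 = begin
        y + 4         ≡⟨ +-suc y 3 ⟩
        suc y + 3     ≤⟨ +-monoˡ-≤ 3 y<n ⟩
        n + 3         ≤⟨ +-monoʳ-≤ n (m≤n+m 3 e) ⟩
        n + (e + 3)   ∎
        where open ≤-Reasoning

    run-of-four⇒few : ∀ k e → e ≤ 1 →
      InClass (2 * k + e) → InClass (2 * (1 + k) + e) →
      InClass (2 * (2 + k) + e) → InClass (2 * (3 + k) + e) →
      ∑< m blockCount ≤ 4
    run-of-four⇒few k e e≤1 h₀ h₁ h₂ h₃ = begin
      ∑< m blockCount                ≡⟨ ∑<-periodic-shift m blockCount blockCount-periodic k ⟨
      ∑[ j < m ] blockCount (k + j)  ≤⟨ ∑<-≤-support m 4 _ (λ j → blockCount≤1 (k + j)) vacant ⟩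
      4                              ∎
      where
      open ≤-Reasoning
      later : ∀ t a d → 2 * (t + a) + d ≡ 2 * a + d + 2 * t
      later = solve-∀
      block-offset : ∀ a b d → 2 * (a + b) + d ≡ 2 * a + (2 * b + d)
      block-offset = solve-∀
      confined : ∀ y → 8 ≤ y → y < n → ¬ InClass (2 * k + y)
      confined = run-of-four⇒confined (2 * k) e e≤1 h₀
        (subst InClass (later 1 k e) h₁)
        (subst InClass (later 2 k e) h₂)
        (subst InClass (later 3 k e) h₃)
      vacant : ∀ j → 4 ≤ j → j < m → blockCount (k + j) ≡ 0
      vacant j 4≤j j<m = blockCount-vacant (k + j) λ e′ e′≤1 h →
        confined (2 * j + e′) (≤-trans (*-monoʳ-≤ 2 4≤j) (m≤m+n (2 * j) e′)) (2*j+e<n j<m e′≤1)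
                 (subst InClass (block-offset k j e′) h)

    window-has-vacancy : 4 < ∑< m blockCount → ∀ k → ∃[ t ] t < 4 × blockCount (t + k) ≡ 0
    window-has-vacancy many k
      with block-occupancy k | block-occupancy (1 + k) | block-occupancy (2 + k) | block-occupancy (3 + k)
    ... | inj₁ z | _      | _      | _      = 0 , s≤s z≤n , z
    ... | inj₂ _ | inj₁ z | _      | _      = 1 , s≤s (s≤s z≤n) , z
    ... | inj₂ _ | inj₂ _ | inj₁ z | _      = 2 , s≤s (s≤s (s≤s z≤n)) , z
    ... | inj₂ _ | inj₂ _ | inj₂ _ | inj₁ z = 3 , ≤-refl , z
    ... | inj₂ (e , e≤1 , h₀) | inj₂ (e₁ , e₁≤1 , h₁) | inj₂ (e₂ , e₂≤1 , h₂) | inj₂ (e₃ , e₃≤1 , h₃)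
      with occupied-consecutive k e≤1 e₁≤1 h₀ h₁
         | occupied-consecutive (1 + k) e₁≤1 e₂≤1 h₁ h₂
         | occupied-consecutive (2 + k) e₂≤1 e₃≤1 h₂ h₃
    ... | refl | refl | refl = contradiction (run-of-four⇒few k e e≤1 h₀ h₁ h₂ h₃) (<⇒≱ many)

    4*∑blockCount≤m*3 : 4 < ∑< m blockCount → 4 * ∑< m blockCount ≤ m * 3
    4*∑blockCount≤m*3 many = ∑<-window-average m 4 3 blockCount blockCount-periodic window
      where
      window : ∀ k → ∑[ t < 4 ] blockCount (t + k) ≤ 3
      window k with window-has-vacancy many k
      ... | t , t<4 , vacant = ≤-pred (∑<-< 4 _ (λ t → blockCount≤1 (t + k)) t t<4 vacant)

18≤n≤2s+4⇒4<s : ∀ n s → 18 ≤ n → n ≤ 2 * s + 4 → 4 < s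
18≤n≤2s+4⇒4<s n s 18≤n n≤2s+4 = ≤-trans (s≤s (s≤s (s≤s (s≤s (s≤s z≤n)))))
  (*-cancelˡ-≤ {7} {s} 2 (+-cancelʳ-≤ 4 14 (2 * s) (≤-trans 18≤n n≤2s+4)))

2m≤2s+4⇒4s≤3m⇒2m≤16 : ∀ m s → m * 2 ≤ 2 * s + 4 → 4 * s ≤ m * 3 → m * 2 ≤ 16
2m≤2s+4⇒4s≤3m⇒2m≤16 m s 2m≤2s+4 4s≤3m = +-cancelʳ-≤ (m * 6) (m * 2) 16 (begin
  m * 2 + m * 6     ≡⟨ eight-m m ⟨
  4 * (m * 2)       ≤⟨ *-monoʳ-≤ 4 2m≤2s+4 ⟩
  4 * (2 * s + 4)   ≡⟨ distribute s ⟩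
  2 * (4 * s) + 16  ≤⟨ +-monoˡ-≤ 16 (*-monoʳ-≤ 2 4s≤3m) ⟩
  2 * (m * 3) + 16  ≡⟨ six-m m ⟩
  16 + m * 6        ∎)
  where
  open ≤-Reasoning
  eight-m : ∀ m → 4 * (m * 2) ≡ m * 2 + m * 6
  eight-m = solve-∀
  distribute : ∀ s → 4 * (2 * s + 4) ≡ 2 * (4 * s) + 16
  distribute = solve-∀
  six-m : ∀ m → 2 * (m * 3) + 16 ≡ 16 + m * 6
  six-m = solve-∀

corollary2p7 : (n : ℕ) .{{_ : NonZero n}} → 18 ≤ n → 2 ∣ n →
    (ℓ : ℕ) (c : Fin n → Fin ℓ) → Proper n c →
    (Σ (Fin ℓ) λ i → n ≤ 2 * classSize c i + 4) →
    ¬ TotalDominator n c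
corollary2p7 n 18≤n (divides m n≡m*2) ℓ c proper (i , n≤2|Vᵢ|+4) td =
  <⇒≱ (m<n+m 16 {2} (s≤s z≤n)) (≤-trans (subst (18 ≤_) n≡m*2 18≤n) 2m≤16)
  where
  open ColourClass n m n≡m*2 (≤-trans (s≤s (s≤s (s≤s (s≤s z≤n)))) 18≤n) c proper i
  size : ℕ
  size = ∑< m blockCount
  n≤2size+4 : n ≤ 2 * size + 4
  n≤2size+4 = subst (λ s → n ≤ 2 * s + 4) classSize≡∑blockCount n≤2|Vᵢ|+4
  2m≤16 : m * 2 ≤ 16
  2m≤16 = 2m≤2s+4⇒4s≤3m⇒2m≤16 m size (subst (_≤ 2 * size + 4) n≡m*2 n≤2size+4)
            (4*∑blockCount≤m*3 td (18≤n≤2s+4⇒4<s n size 18≤n n≤2size+4))
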